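{- Let $n\ge 1$ and let $f:\{0,1\}^n\to\{0,1\}$ be a Boolean function. If for every $i\in\{1,\dots,n\}$ and every $j\in\{0,1\}$ there exists $x\in\{0,1\}^n$ with $x_i=j$ and $f(x)=1$, then $$|\{x : f(x)=1\}|\ \ge\ 2^{n-s_1(f)+1}-2^{n-2s_1(f)}.$$
   Context: For $x\in\{0,1\}^n$, $x^{(i)}$ denotes $x$ with the $i$-th bit flipped. The sensitivity of $f$ at $x$ is $s(f,x)=|\{i : f(x)\ne f(x^{(i)})\}|$, and the $1$-sensitivity is $s_1(f)=\max\{s(f,x) : x\in\{0,1\}^n,\ f(x)=1\}$. -}

module Defs where

open import Data.Bool using (Bool; true; false; not; _xor_)
open import Data.Nat using (ℕ; zero; suc; _⊔_)
open import Data.Fin using (Fin)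
open import Data.Vec using (Vec; []; _∷_; _[_]%=_)
open import Data.List using (List; []; _∷_; map; _++_; length; filterᵇ; foldr; allFin)

-- The Boolean cube {0,1}^n, bits as Bool (false = 0, true = 1).
Cube : ℕ → Set
Cube n = Vec Bool n

BoolFun : ℕ → Set
BoolFun n = Cube n → Bool

allCube : (n : ℕ) → List (Cube n)
allCube zero = [] ∷ []
allCube (suc n) = map (false ∷_) (allCube n) ++ map (true ∷_) (allCube n)

flipAt : {n : ℕ} → Fin n → Cube n → Cube n
flipAt i x = x [ i ]%= not

sens : {n : ℕ} → BoolFun n → Cube n → ℕ
sens {n} f x = length (filterᵇ (λ i → f x xor f (flipAt i x)) (allFin n))

-- s_1(f) = max { s(f,x) : f(x) = 1 }  (0 if f has no 1-input)
s₁ : {n : ℕ} → BoolFun n → ℕ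
s₁ {n} f = foldr _⊔_ 0 (map (sens f) (filterᵇ f (allCube n)))

weight : {n : ℕ} → BoolFun n → ℕ
weight {n} f = length (filterᵇ f (allCube n))

-- We prove, by strong induction on the dimension k of a subcube F, the claim:
-- if P meets F, spans F (both halves of F along every free coordinate meet P)
-- and every 1-point of P has at most s sensitive directions inside F, then
-- 2^(k+s+1) ≤ 2^(2s)·|P ∩ F| + 2^k.  In the induction, a free direction
-- whose two halves are spanned is handled by the hypothesis on both halves.
-- Otherwise F has a quarter missing P; a descent on the opposite quarter
-- yields either two opposite empty quarters (the other two quarters are then
-- isolated and the Simon lemma applies at sensitivity s - 2) or an empty
-- quarter whose adjacent halves are spanned: folding each half onto the
-- opposite quarter lowers the sensitivity to s - 1, and averaging the two
-- resulting bounds gives the claim.  The corollary is the claim for the whole cube.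

module Submission where

open import Defs
open import Data.Bool using (Bool; true; false; not; _xor_; _∨_; _∧_; T)
open import Data.Bool.Properties
  using (not-involutive; T?; ∧-comm; ∨-zeroʳ; ∨-identityʳ) renaming (_≟_ to _≟ᵇ_)
open import Data.Nat using (ℕ; zero; suc; _+_; _*_; _^_; _≤_; _<_; z≤n; s≤s; s≤s⁻¹; _⊔_; _≟_)
open import Data.Nat.Properties
open import Data.Nat.Induction using (<-rec)
open import Data.Nat.Solver using (module +-*-Solver)
open import Algebra.Properties.CommutativeSemigroup +-commutativeSemigroup
  using (x∙yz≈y∙xz) renaming (interchange to +-interchange)
open import Data.Fin using (Fin; zero; suc)
open import Data.Fin.Properties using (any?)
open import Data.Vec using (Vec; []; _∷_; lookup; _[_]≔_; replicate)
open import Data.Vec.Properties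
  using (lookup∘update; lookup∘update′; lookup∘updateAt; lookup∘updateAt′; []≔-commutes; []≔-idempotent)
open import Data.List using (List; []; _∷_; map; _++_; length; filterᵇ; foldr; tabulate; allFin)
open import Data.List.Properties using (filter-++; length-++; map-tabulate)
open import Data.List.Membership.Propositional using (_∈_)
open import Data.List.Membership.Propositional.Properties using (∈-map⁺; ∈-++⁺ˡ; ∈-++⁺ʳ; ∈-filter⁺)
open import Data.List.Relation.Unary.Any using (here; there)
open import Data.Maybe using (Maybe; just; nothing)
open import Data.Maybe.Properties using (≡-dec)
open import Data.Product using (Σ; _×_; _,_; proj₁; proj₂)
open import Data.Sum using (_⊎_; inj₁; inj₂; [_,_]′)
open import Data.Empty using (⊥-elim)
open import Data.Unit using (⊤; tt)
open import Relation.Nullary using (¬_; Dec; yes; no)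
open import Relation.Binary.PropositionalEquality
open import Function using (id)

-- A subcube of {0,1}^n: every coordinate is either fixed to a bit or free.
Subcube : ℕ → Set
Subcube n = Vec (Maybe Bool) n

Agree : ∀ {n} → Subcube n → Cube n → Set
Agree [] [] = ⊤
Agree (nothing ∷ F) (b ∷ x) = Agree F x
Agree (just c ∷ F) (b ∷ x) = b ≡ c × Agree F x

dim : ∀ {n} → Subcube n → ℕ
dim [] = 0
dim (nothing ∷ F) = suc (dim F)
dim (just _ ∷ F) = dim F

ind : Bool → ℕ
ind true = 1
ind false = 0

sumOver : ∀ {n} → Subcube n → (Cube n → ℕ) → ℕ
sumOver [] g = g []
sumOver (nothing ∷ F) g = sumOver F (λ x → g (false ∷ x)) + sumOver F (λ x → g (true ∷ x))
sumOver (just c ∷ F) g = sumOver F (λ x → g (c ∷ x))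

count : ∀ {n} → Subcube n → (Cube n → Bool) → ℕ
count F P = sumOver F (λ x → ind (P x))

-- s_F(P, x): the number of free directions of F along which P is 0 at the
-- neighbour of x; for a 1-point x this is its sensitivity inside F.
sensIn : ∀ {n} → Subcube n → (Cube n → Bool) → Cube n → ℕ
sensIn [] P [] = 0
sensIn (nothing ∷ F) P (b ∷ x) = ind (not (P (not b ∷ x))) + sensIn F (λ y → P (b ∷ y)) x
sensIn (just _ ∷ F) P (b ∷ x) = sensIn F (λ y → P (b ∷ y)) x

whole : ∀ n → Subcube n
whole n = replicate n nothing

fix2 : ∀ {n} → Subcube n → Fin n → Bool → Fin n → Bool → Subcube n
fix2 F i a j b = (F [ i ]≔ just a) [ j ]≔ just b

sumOver-ext : ∀ {n} (F : Subcube n) {g h : Cube n → ℕ} → (∀ x → Agree F x → g x ≡ h x) →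
              sumOver F g ≡ sumOver F h
sumOver-ext [] e = e [] tt
sumOver-ext (nothing ∷ F) e =
  cong₂ _+_ (sumOver-ext F (λ x → e (false ∷ x))) (sumOver-ext F (λ x → e (true ∷ x)))
sumOver-ext (just c ∷ F) e = sumOver-ext F (λ x a → e (c ∷ x) (refl , a))

sumOver-mono : ∀ {n} (F : Subcube n) {g h : Cube n → ℕ} → (∀ x → Agree F x → g x ≤ h x) →
               sumOver F g ≤ sumOver F h
sumOver-mono [] e = e [] tt
sumOver-mono (nothing ∷ F) e =
  +-mono-≤ (sumOver-mono F (λ x → e (false ∷ x))) (sumOver-mono F (λ x → e (true ∷ x)))
sumOver-mono (just c ∷ F) e = sumOver-mono F (λ x a → e (c ∷ x) (refl , a))

sumOver-+ : ∀ {n} (F : Subcube n) (g h : Cube n → ℕ) →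
            sumOver F (λ x → g x + h x) ≡ sumOver F g + sumOver F h
sumOver-+ [] g h = refl
sumOver-+ (nothing ∷ F) g h =
  trans (cong₂ _+_ (sumOver-+ F g₀ h₀) (sumOver-+ F g₁ h₁))
        (+-interchange (sumOver F g₀) (sumOver F h₀) (sumOver F g₁) (sumOver F h₁))
  where g₀ g₁ h₀ h₁ : Cube _ → ℕ
        g₀ x = g (false ∷ x)
        g₁ x = g (true ∷ x)
        h₀ x = h (false ∷ x)
        h₁ x = h (true ∷ x)
sumOver-+ (just c ∷ F) g h = sumOver-+ F (λ x → g (c ∷ x)) (λ x → h (c ∷ x))

sumOver-* : ∀ {n} (F : Subcube n) (k : ℕ) (g : Cube n → ℕ) →
            sumOver F (λ x → k * g x) ≡ k * sumOver F g
sumOver-* [] k g = refl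
sumOver-* (nothing ∷ F) k g =
  trans (cong₂ _+_ (sumOver-* F k _) (sumOver-* F k _)) (sym (*-distribˡ-+ k _ _))
sumOver-* (just c ∷ F) k g = sumOver-* F k _

sumOver-zero : ∀ {n} (F : Subcube n) (g : Cube n → ℕ) → sumOver F g ≡ 0 →
               ∀ x → Agree F x → g x ≡ 0
sumOver-zero [] g e [] a = e
sumOver-zero (nothing ∷ F) g e (false ∷ x) a = sumOver-zero F _ (m+n≡0⇒m≡0 _ e) x a
sumOver-zero (nothing ∷ F) g e (true ∷ x) a = sumOver-zero F _ (m+n≡0⇒n≡0 _ e) x a
sumOver-zero (just c ∷ F) g e (b ∷ x) (refl , a) = sumOver-zero F _ e x a

sumOver-term : ∀ {n} (F : Subcube n) (g : Cube n → ℕ) → ∀ x → Agree F x → g x ≤ sumOver F g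
sumOver-term [] g [] a = ≤-refl
sumOver-term (nothing ∷ F) g (false ∷ x) a = ≤-trans (sumOver-term F _ x a) (m≤m+n _ _)
sumOver-term (nothing ∷ F) g (true ∷ x) a = ≤-trans (sumOver-term F _ x a) (m≤n+m _ _)
sumOver-term (just c ∷ F) g (b ∷ x) (refl , a) = sumOver-term F _ x a

sumOver-pos : ∀ {n} (F : Subcube n) (g : Cube n → ℕ) → 1 ≤ sumOver F g →
              Σ (Cube n) (λ x → Agree F x × 1 ≤ g x)
sumOver-pos [] g h = [] , tt , h
sumOver-pos (nothing ∷ F) g h with sumOver F (λ x → g (false ∷ x)) in eq
... | suc _ = let (x , a , p) = sumOver-pos F _ (subst (1 ≤_) (sym eq) (s≤s z≤n)) in (false ∷ x) , a , p
... | zero = let (x , a , p) = sumOver-pos F _ h in (true ∷ x) , a , p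
sumOver-pos (just c ∷ F) g h = let (x , a , p) = sumOver-pos F _ h in (c ∷ x) , (refl , a) , p

sumOver-split : ∀ {n} (F : Subcube n) (i : Fin n) (g : Cube n → ℕ) → lookup F i ≡ nothing →
                sumOver F g ≡ sumOver (F [ i ]≔ just false) g + sumOver (F [ i ]≔ just true) g
sumOver-split (nothing ∷ F) zero g e = refl
sumOver-split (nothing ∷ F) (suc i) g e =
  trans (cong₂ _+_ (sumOver-split F i g₀ e) (sumOver-split F i g₁ e))
        (+-interchange (sumOver (F [ i ]≔ just false) g₀) (sumOver (F [ i ]≔ just true) g₀)
                       (sumOver (F [ i ]≔ just false) g₁) (sumOver (F [ i ]≔ just true) g₁))
  where g₀ g₁ : Cube _ → ℕ
        g₀ x = g (false ∷ x)
        g₁ x = g (true ∷ x)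
sumOver-split (just c ∷ F) (suc i) g e = sumOver-split F i _ e

sumOver-flip : ∀ {n} (F : Subcube n) (i : Fin n) (c : Bool) (g : Cube n → ℕ) → lookup F i ≡ just c →
               sumOver F (λ x → g (flipAt i x)) ≡ sumOver (F [ i ]≔ just (not c)) g
sumOver-flip (just c ∷ F) zero .c g refl = refl
sumOver-flip (nothing ∷ F) (suc i) c g e = cong₂ _+_ (sumOver-flip F i c _ e) (sumOver-flip F i c _ e)
sumOver-flip (just c' ∷ F) (suc i) c g e = sumOver-flip F i c _ e

agree-unfix : ∀ {n} (F : Subcube n) (i : Fin n) (c : Bool) x → lookup F i ≡ nothing →
              Agree (F [ i ]≔ just c) x → Agree F x
agree-unfix (nothing ∷ F) zero c (b ∷ x) e (_ , a) = a
agree-unfix (nothing ∷ F) (suc i) c (b ∷ x) e a = agree-unfix F i c x e a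
agree-unfix (just c' ∷ F) (suc i) c (b ∷ x) e (h , a) = h , agree-unfix F i c x e a

agree-fix : ∀ {n} (F : Subcube n) (i : Fin n) (c : Bool) x → Agree F x → lookup x i ≡ c →
            Agree (F [ i ]≔ just c) x
agree-fix (nothing ∷ F) zero c (b ∷ x) a e = e , a
agree-fix (just c' ∷ F) zero c (b ∷ x) (_ , a) e = e , a
agree-fix (nothing ∷ F) (suc i) c (b ∷ x) a e = agree-fix F i c x a e
agree-fix (just c' ∷ F) (suc i) c (b ∷ x) (h , a) e = h , agree-fix F i c x a e

agree-flip : ∀ {n} (F : Subcube n) (i : Fin n) (c : Bool) x → lookup F i ≡ just c → Agree F x →
             Agree (F [ i ]≔ just (not c)) (flipAt i x)
agree-flip (just c ∷ F) zero .c (b ∷ x) refl (h , a) = cong not h , a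
agree-flip (nothing ∷ F) (suc i) c (b ∷ x) e a = agree-flip F i c x e a
agree-flip (just c' ∷ F) (suc i) c (b ∷ x) e (h , a) = h , agree-flip F i c x e a

agree-fixed : ∀ {n} (F : Subcube n) (i : Fin n) (c : Bool) x → Agree (F [ i ]≔ just c) x → lookup x i ≡ c
agree-fixed (m ∷ F) zero c (b ∷ x) (e , a) = e
agree-fixed (nothing ∷ F) (suc i) c (b ∷ x) a = agree-fixed F i c x a
agree-fixed (just c' ∷ F) (suc i) c (b ∷ x) (_ , a) = agree-fixed F i c x a

agree-whole : ∀ n (x : Cube n) → Agree (whole n) x
agree-whole zero [] = tt
agree-whole (suc n) (b ∷ x) = agree-whole n x

flipAt-involutive : ∀ {n} (i : Fin n) (x : Cube n) → flipAt i (flipAt i x) ≡ x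
flipAt-involutive zero (b ∷ x) = cong (_∷ x) (not-involutive b)
flipAt-involutive (suc i) (b ∷ x) = cong (b ∷_) (flipAt-involutive i x)

agree-flip-free : ∀ {n} (F : Subcube n) (i : Fin n) x → lookup F i ≡ nothing → Agree F x → Agree F (flipAt i x)
agree-flip-free (nothing ∷ F) zero (b ∷ x) e a = a
agree-flip-free (nothing ∷ F) (suc i) (b ∷ x) e a = agree-flip-free F i x e a
agree-flip-free (just c ∷ F) (suc i) (b ∷ x) e (h , a) = h , agree-flip-free F i x e a

lookup-flip : ∀ {n} (i : Fin n) (x : Cube n) → lookup (flipAt i x) i ≡ not (lookup x i)
lookup-flip i x = lookup∘updateAt i x

lookup-flip-other : ∀ {n} (i j : Fin n) (x : Cube n) → i ≢ j → lookup (flipAt i x) j ≡ lookup x j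
lookup-flip-other i j x ne = lookup∘updateAt′ j i (≢-sym ne) x

dim-fix : ∀ {n} (F : Subcube n) (i : Fin n) (c : Bool) → lookup F i ≡ nothing →
          dim F ≡ suc (dim (F [ i ]≔ just c))
dim-fix (nothing ∷ F) zero c e = refl
dim-fix (nothing ∷ F) (suc i) c e = cong suc (dim-fix F i c e)
dim-fix (just c' ∷ F) (suc i) c e = dim-fix F i c e

free-exists : ∀ {n} (F : Subcube n) k → dim F ≡ suc k → Σ (Fin n) (λ i → lookup F i ≡ nothing)
free-exists (nothing ∷ F) k e = zero , refl
free-exists (just c ∷ F) k e = let (i , h) = free-exists F k e in suc i , h

dim-whole : ∀ n → dim (whole n) ≡ n
dim-whole zero = refl
dim-whole (suc n) = cong suc (dim-whole n)

sensIn-fix : ∀ {n} (F : Subcube n) (i : Fin n) (c : Bool) (P : Cube n → Bool) x → lookup F i ≡ nothing →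
             sensIn F P x ≡ ind (not (P (flipAt i x))) + sensIn (F [ i ]≔ just c) P x
sensIn-fix (nothing ∷ F) zero c P (b ∷ x) e = refl
sensIn-fix (nothing ∷ F) (suc i) c P (b ∷ x) e =
  trans (cong (ind (not (P (not b ∷ x))) +_) (sensIn-fix F i c (λ y → P (b ∷ y)) x e))
        (x∙yz≈y∙xz (ind (not (P (not b ∷ x)))) (ind (not (P (b ∷ flipAt i x))))
                   (sensIn (F [ i ]≔ just c) (λ y → P (b ∷ y)) x))
sensIn-fix (just c' ∷ F) (suc i) c P (b ∷ x) e = sensIn-fix F i c (λ y → P (b ∷ y)) x e

-- The sensitivity is the same in both halves of a split (it ignores fixed coordinates).
sensIn-refix : ∀ {n} (F : Subcube n) (i : Fin n) (a b : Bool) (P : Cube n → Bool) x →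
               sensIn (F [ i ]≔ just a) P x ≡ sensIn (F [ i ]≔ just b) P x
sensIn-refix (m ∷ F) zero a b P (y ∷ x) = refl
sensIn-refix (nothing ∷ F) (suc i) a b P (y ∷ x) =
  cong (ind (not (P (not y ∷ x))) +_) (sensIn-refix F i a b (λ z → P (y ∷ z)) x)
sensIn-refix (just c ∷ F) (suc i) a b P (y ∷ x) = sensIn-refix F i a b (λ z → P (y ∷ z)) x

ind-not-antitone : ∀ a b → (a ≡ true → b ≡ true) → ind (not b) ≤ ind (not a)
ind-not-antitone true b h rewrite h refl = z≤n
ind-not-antitone false true h = z≤n
ind-not-antitone false false h = ≤-refl

sensIn-antitone : ∀ {n} (F : Subcube n) (P Q : Cube n → Bool) → (∀ y → P y ≡ true → Q y ≡ true) →
                  ∀ x → sensIn F Q x ≤ sensIn F P x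
sensIn-antitone [] P Q h [] = z≤n
sensIn-antitone (nothing ∷ F) P Q h (b ∷ x) =
  +-mono-≤ (ind-not-antitone (P (not b ∷ x)) (Q (not b ∷ x)) (h (not b ∷ x)))
           (sensIn-antitone F (λ y → P (b ∷ y)) (λ y → Q (b ∷ y)) (λ y → h (b ∷ y)) x)
sensIn-antitone (just c ∷ F) P Q h (b ∷ x) =
  sensIn-antitone F (λ y → P (b ∷ y)) (λ y → Q (b ∷ y)) (λ y → h (b ∷ y)) x

sensIn-flip : ∀ {n} (F : Subcube n) (i : Fin n) (c : Bool) (P : Cube n → Bool) x → lookup F i ≡ just c →
              sensIn F (λ y → P (flipAt i y)) x ≡ sensIn F P (flipAt i x)
sensIn-flip (just c ∷ F) zero .c P (b ∷ x) refl = refl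
sensIn-flip (nothing ∷ F) (suc i) c P (b ∷ x) e =
  cong (ind (not (P (not b ∷ flipAt i x))) +_) (sensIn-flip F i c (λ y → P (b ∷ y)) x e)
sensIn-flip (just c' ∷ F) (suc i) c P (b ∷ x) e = sensIn-flip F i c (λ y → P (b ∷ y)) x e

-- The weighted Simon lemma, the basic counting tool.

weightOf : Bool → ℕ → ℕ
weightOf true m = 2 ^ m
weightOf false m = 0

simonWeight : ∀ {n} → Subcube n → (Cube n → Bool) → Cube n → ℕ
simonWeight F P x = weightOf (P x) (sensIn F P x)

weightOf-mono : ∀ a k m → weightOf a m ≤ weightOf a (k + m)
weightOf-mono true k m = ^-monoʳ-≤ 2 (m≤n+m m k)
weightOf-mono false k m = z≤n

-- If P misses the (¬b)-half of nothing ∷ F, every 1-point of the b-half is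
-- sensitive in the new direction, so its weight doubles.
simonWeight-doubles : ∀ {n} (F : Subcube n) (P : Cube (suc n) → Bool) (b : Bool) →
                      count F (λ y → P (not b ∷ y)) ≡ 0 →
                      sumOver F (λ x → simonWeight (nothing ∷ F) P (b ∷ x)) ≡
                      2 * sumOver F (simonWeight F (λ y → P (b ∷ y)))
simonWeight-doubles F P b e = trans (sumOver-ext F pointwise) (sumOver-* F 2 _)
  where
    pointwise : ∀ x → Agree F x →
                simonWeight (nothing ∷ F) P (b ∷ x) ≡ 2 * simonWeight F (λ y → P (b ∷ y)) x
    pointwise x a with P (not b ∷ x) | sumOver-zero F _ e x a
    ... | false | _ with P (b ∷ x)
    ...   | true = refl
    ...   | false = refl
    pointwise x a | true | ()

weighted-simon : ∀ {n} (F : Subcube n) (P : Cube n → Bool) → 1 ≤ count F P →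
                 2 ^ dim F ≤ sumOver F (simonWeight F P)
weighted-simon [] P h with P []
... | true = ≤-refl
weighted-simon [] P () | false
weighted-simon (just c ∷ F) P h = weighted-simon F (λ y → P (c ∷ y)) h
-- Splitting along the first free coordinate: if both halves meet P, add the two
-- inductive bounds (weights only grow); if one half misses P, the other half's
-- weights double.
weighted-simon (nothing ∷ F) P h with count F P₀ ≟ 0 | count F P₁ ≟ 0
  where P₀ P₁ : Cube _ → Bool
        P₀ y = P (false ∷ y)
        P₁ y = P (true ∷ y)
... | yes e₀ | yes e₁ with () ← subst (1 ≤_) (cong₂ _+_ e₀ e₁) h
... | no ne₀ | no ne₁ =
  subst (_≤ W₀ + W₁) (cong (2 ^ dim F +_) (sym (+-identityʳ (2 ^ dim F))))
        (+-mono-≤ (≤-trans (weighted-simon F _ (n≢0⇒n>0 ne₀))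
                           (sumOver-mono F (λ x _ → weightOf-mono (P (false ∷ x)) (ind (not (P (true ∷ x)))) _)))
                  (≤-trans (weighted-simon F _ (n≢0⇒n>0 ne₁))
                           (sumOver-mono F (λ x _ → weightOf-mono (P (true ∷ x)) (ind (not (P (false ∷ x)))) _))))
  where W₀ W₁ : ℕ
        W₀ = sumOver F (λ x → simonWeight (nothing ∷ F) P (false ∷ x))
        W₁ = sumOver F (λ x → simonWeight (nothing ∷ F) P (true ∷ x))
... | no ne₀ | yes e₁ =
  ≤-trans (*-monoʳ-≤ 2 (weighted-simon F _ (n≢0⇒n>0 ne₀)))
          (≤-trans (≤-reflexive (sym (simonWeight-doubles F P false e₁))) (m≤m+n _ _))
... | yes e₀ | no ne₁ =
  ≤-trans (*-monoʳ-≤ 2 (weighted-simon F _ (n≢0⇒n>0 ne₁)))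
          (≤-trans (≤-reflexive (sym (simonWeight-doubles F P true e₀))) (m≤n+m _ _))

-- The target inequality: Bound k s c says 2^(k+s+1) ≤ 2^(2s)·c + 2^k, i.e. c ≥ 2^(k-s+1) - 2^(k-2s).
Bound : ℕ → ℕ → ℕ → Set
Bound k s c = 2 ^ (k + s + 1) ≤ 2 ^ (2 * s) * c + 2 ^ k

Bound′ : ℕ → ℕ → ℕ → Set
Bound′ k s c = 2 * (2 ^ k * 2 ^ s) ≤ (2 ^ s * 2 ^ s) * c + 2 ^ k

module _ (k s c : ℕ) where
  private
    pow-k+s+1 : 2 ^ (k + s + 1) ≡ 2 * (2 ^ k * 2 ^ s)
    pow-k+s+1 = trans (^-distribˡ-+-* 2 (k + s) 1)
                      (trans (cong (_* 2) (^-distribˡ-+-* 2 k s)) (*-comm (2 ^ k * 2 ^ s) 2))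

    pow-2s : 2 ^ (2 * s) ≡ 2 ^ s * 2 ^ s
    pow-2s = trans (cong (λ t → 2 ^ (s + t)) (+-identityʳ s)) (^-distribˡ-+-* 2 s s)

  Bound′⇒Bound : Bound′ k s c → Bound k s c
  Bound′⇒Bound = subst₂ (λ a b → a ≤ b * c + 2 ^ k) (sym pow-k+s+1) (sym pow-2s)

  Bound⇒Bound′ : Bound k s c → Bound′ k s c
  Bound⇒Bound′ = subst₂ (λ a b → a ≤ b * c + 2 ^ k) pow-k+s+1 pow-2s

bound-point : ∀ s c → 1 ≤ c → Bound 0 s c
bound-point s c h = ≤-trans (pow-s+1 s) (+-monoˡ-≤ 1 (subst (_≤ 2 ^ (2 * s) * c) (*-identityʳ (2 ^ (2 * s)))
                                                         (*-monoʳ-≤ (2 ^ (2 * s)) h)))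
  where
    pow-s+1 : ∀ s → 2 ^ (s + 1) ≤ 2 ^ (2 * s) + 1
    pow-s+1 zero = ≤-refl
    pow-s+1 (suc s) = ≤-trans (^-monoʳ-≤ 2 (+-monoʳ-≤ (suc s) (s≤s (z≤n {s + 0})))) (m≤m+n _ 1)

bound-halves : ∀ k s c₀ c₁ → Bound k s c₀ → Bound k s c₁ → Bound (suc k) s (c₀ + c₁)
bound-halves k s c₀ c₁ h₀ h₁ =
  subst₂ _≤_ (double (2 ^ (k + s + 1))) (regroup (2 ^ (2 * s)) c₀ c₁ (2 ^ k)) (+-mono-≤ h₀ h₁)
  where
    open +-*-Solver
    double : ∀ G → G + G ≡ 2 * G
    double = solve 1 (λ G → G :+ G := con 2 :* G) refl
    regroup : ∀ V c₀ c₁ K → (V * c₀ + K) + (V * c₁ + K) ≡ V * (c₀ + c₁) + 2 * K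
    regroup = solve 4 (λ V c₀ c₁ K → (V :* c₀ :+ K) :+ (V :* c₁ :+ K) := V :* (c₀ :+ c₁) :+ con 2 :* K) refl

bound-diagonal : ∀ k s X Y → 2 ^ k ≤ 2 ^ s * X → 2 ^ k ≤ 2 ^ s * Y → Bound k s (X + Y)
bound-diagonal k s X Y hx hy = Bound′⇒Bound k s (X + Y)
  (≤-trans (≤-reflexive (e₁ K U))
  (≤-trans (*-monoʳ-≤ U (+-mono-≤ hx hy))
  (≤-trans (≤-reflexive (e₂ U X Y)) (m≤m+n _ K))))
  where
    open +-*-Solver
    K U : ℕ
    K = 2 ^ k
    U = 2 ^ s
    e₁ : ∀ K U → 2 * (K * U) ≡ U * (K + K)
    e₁ = solve 2 (λ K U → con 2 :* (K :* U) := U :* (K :+ K)) refl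
    e₂ : ∀ U X Y → U * (U * X + U * Y) ≡ (U * U) * (X + Y)
    e₂ = solve 3 (λ U X Y → U :* (U :* X :+ U :* Y) := (U :* U) :* (X :+ Y)) refl

-- Folding: a (k+2)-dimensional half consists of two quarters with Z and X
-- points, and its fold onto the first quarter has A = Z + X - J points.  The
-- bound for A at sensitivity s and the Simon bound 2^(k+2) ≤ 2^(s+1)·(X + J)
-- give the bound for Z + 2X at sensitivity s + 1.
bound-fold : ∀ k s A J X Z → Bound k s A → 2 ^ suc (suc k) ≤ 2 ^ suc s * (X + J) → A + J ≡ Z + X →
             Bound (suc (suc k)) (suc s) (Z + (X + X))
bound-fold k s A J X Z ih hl ce = Bound′⇒Bound (suc (suc k)) (suc s) (Z + (X + X))
  (≤-trans (≤-reflexive (eL K U))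
  (≤-trans (+-mono-≤ (*-monoʳ-≤ 4 (Bound⇒Bound′ k s A ih)) (*-monoʳ-≤ (2 * U) hl))
  (≤-reflexive (trans (eR U A K X J) (trans (cong (λ t → (4 * (U * U)) * (t + X) + 4 * K) ce) (eR₂ U Z X K))))))
  where
    open +-*-Solver
    K U : ℕ
    K = 2 ^ k
    U = 2 ^ s
    eL : ∀ K U → 2 * ((2 * (2 * K)) * (2 * U)) ≡ 4 * (2 * (K * U)) + (2 * U) * (2 * (2 * K))
    eL = solve 2 (λ K U → con 2 :* ((con 2 :* (con 2 :* K)) :* (con 2 :* U))
                    := con 4 :* (con 2 :* (K :* U)) :+ (con 2 :* U) :* (con 2 :* (con 2 :* K))) refl
    eR : ∀ U A K X J → 4 * ((U * U) * A + K) + (2 * U) * ((2 * U) * (X + J)) ≡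
                       (4 * (U * U)) * ((A + J) + X) + 4 * K
    eR = solve 5 (λ U A K X J → con 4 :* ((U :* U) :* A :+ K) :+ (con 2 :* U) :* ((con 2 :* U) :* (X :+ J))
                      := (con 4 :* (U :* U)) :* ((A :+ J) :+ X) :+ con 4 :* K) refl
    eR₂ : ∀ U Z X K → (4 * (U * U)) * ((Z + X) + X) + 4 * K ≡
                      ((2 * U) * (2 * U)) * (Z + (X + X)) + 2 * (2 * K)
    eR₂ = solve 4 (λ U Z X K → (con 4 :* (U :* U)) :* ((Z :+ X) :+ X) :+ con 4 :* K
                      := ((con 2 :* U) :* (con 2 :* U)) :* (Z :+ (X :+ X)) :+ con 2 :* (con 2 :* K)) refl

bound-average : ∀ k s X Y Z → Bound k s (Z + (X + X)) → Bound k s (Z + (Y + Y)) → Bound k s (X + (Y + Z))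
bound-average k s X Y Z h₁ h₂ =
  *-cancelˡ-≤ 2 (subst₂ _≤_ (double G) (regroup V K X Y Z) (+-mono-≤ h₁ h₂))
  where
    open +-*-Solver
    G V K : ℕ
    G = 2 ^ (k + s + 1)
    V = 2 ^ (2 * s)
    K = 2 ^ k
    double : ∀ G → G + G ≡ 2 * G
    double = solve 1 (λ G → G :+ G := con 2 :* G) refl
    regroup : ∀ V K X Y Z → (V * (Z + (X + X)) + K) + (V * (Z + (Y + Y)) + K) ≡ 2 * (V * (X + (Y + Z)) + K)
    regroup = solve 5 (λ V K X Y Z → (V :* (Z :+ (X :+ X)) :+ K) :+ (V :* (Z :+ (Y :+ Y)) :+ K)
                      := con 2 :* (V :* (X :+ (Y :+ Z)) :+ K)) refl

count-split : ∀ {n} (F : Subcube n) (i : Fin n) (c : Bool) (P : Cube n → Bool) → lookup F i ≡ nothing →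
              count F P ≡ count (F [ i ]≔ just c) P + count (F [ i ]≔ just (not c)) P
count-split F i false P e = sumOver-split F i _ e
count-split F i true P e =
  trans (sumOver-split F i _ e) (+-comm (count (F [ i ]≔ just false) P) (count (F [ i ]≔ just true) P))

count-fix-≤ : ∀ {n} (F : Subcube n) (i : Fin n) (c : Bool) (P : Cube n → Bool) → lookup F i ≡ nothing →
              count (F [ i ]≔ just c) P ≤ count F P
count-fix-≤ F i c P e = subst (count (F [ i ]≔ just c) P ≤_) (sym (count-split F i c P e)) (m≤m+n _ _)

count-zero⇒false : ∀ {n} (F : Subcube n) (P : Cube n → Bool) → count F P ≡ 0 →
                   ∀ x → Agree F x → P x ≡ false
count-zero⇒false F P z x a with P x | sumOver-zero F _ z x a
... | false | _ = refl
... | true | ()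

count-pos⇒point : ∀ {n} (F : Subcube n) (P : Cube n → Bool) → 1 ≤ count F P →
                  Σ (Cube n) (λ x → Agree F x × P x ≡ true)
count-pos⇒point F P h with sumOver-pos F _ h
... | x , a , p with P x in eq
...   | true = x , a , eq
count-pos⇒point F P h | x , a , () | false

count-point⇒pos : ∀ {n} (F : Subcube n) (P : Cube n → Bool) x → Agree F x → P x ≡ true → 1 ≤ count F P
count-point⇒pos F P x a px = subst (λ b → ind b ≤ count F P) px (sumOver-term F (λ y → ind (P y)) x a)

misses⇒count-zero : ∀ {n} (F : Subcube n) (P : Cube n → Bool) → (∀ x → Agree F x → P x ≡ false) →
                    count F P ≡ 0
misses⇒count-zero [] P h = cong ind (h [] tt)
misses⇒count-zero (nothing ∷ F) P h =
  cong₂ _+_ (misses⇒count-zero F _ (λ x → h (false ∷ x))) (misses⇒count-zero F _ (λ x → h (true ∷ x)))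
misses⇒count-zero (just c ∷ F) P h = misses⇒count-zero F _ (λ x a → h (c ∷ x) (refl , a))

count-≡ : ∀ {n} {G H : Subcube n} (P : Cube n → Bool) → G ≡ H → count G P ≡ count H P
count-≡ P e = cong (λ G → count G P) e

free-other : ∀ {n} (F : Subcube n) (i j : Fin n) (v : Maybe Bool) → i ≢ j → lookup F j ≡ nothing →
             lookup (F [ i ]≔ v) j ≡ nothing
free-other F i j v ne e = trans (lookup∘update′ (≢-sym ne) F v) e

free-unfix : ∀ {n} (F : Subcube n) (i j : Fin n) (c : Bool) → i ≢ j → lookup (F [ i ]≔ just c) j ≡ nothing →
             lookup F j ≡ nothing
free-unfix F i j c ne e = trans (sym (lookup∘update′ (≢-sym ne) F (just c))) e

fixed-≢ : ∀ {n} (F : Subcube n) (i j : Fin n) (c : Bool) → lookup (F [ i ]≔ just c) j ≡ nothing → i ≢ j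
fixed-≢ F i j c e refl with () ← trans (sym (lookup∘update j F (just c))) e

fix2-free : ∀ {n} (F : Subcube n) i a j b k → i ≢ k → j ≢ k → lookup F k ≡ nothing →
            lookup (fix2 F i a j b) k ≡ nothing
fix2-free F i a j b k ik jk fk = free-other (F [ i ]≔ just a) j k (just b) jk (free-other F i k (just a) ik fk)

agree-fix2 : ∀ {n} (F : Subcube n) i a j b x → Agree F x → lookup x i ≡ a → lookup x j ≡ b →
             Agree (fix2 F i a j b) x
agree-fix2 F i a j b x ag xi xj = agree-fix (F [ i ]≔ just a) j b x (agree-fix F i a x ag xi) xj

agree-fix2⁻¹ : ∀ {n} (F : Subcube n) i a j b x → i ≢ j → lookup F i ≡ nothing → lookup F j ≡ nothing →
               Agree (fix2 F i a j b) x → Agree F x × lookup x i ≡ a × lookup x j ≡ b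
agree-fix2⁻¹ F i a j b x ij fi fj ag =
  agree-unfix F i a x fi agᵢ , agree-fixed F i a x agᵢ , agree-fixed (F [ i ]≔ just a) j b x ag
  where agᵢ : Agree (F [ i ]≔ just a) x
        agᵢ = agree-unfix (F [ i ]≔ just a) j b x (free-other F i j (just a) ij fj) ag

agree-fix3 : ∀ {n} (F : Subcube n) i a j b k c x → Agree F x → lookup x i ≡ a → lookup x j ≡ b →
             lookup x k ≡ c → Agree (fix2 F i a j b [ k ]≔ just c) x
agree-fix3 F i a j b k c x ag xi xj xk = agree-fix (fix2 F i a j b) k c x (agree-fix2 F i a j b x ag xi xj) xk

agree-fix3⁻¹ : ∀ {n} (F : Subcube n) i a j b k c x → i ≢ j → i ≢ k → j ≢ k →
               lookup F i ≡ nothing → lookup F j ≡ nothing → lookup F k ≡ nothing →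
               Agree (fix2 F i a j b [ k ]≔ just c) x →
               Agree F x × lookup x i ≡ a × lookup x j ≡ b × lookup x k ≡ c
agree-fix3⁻¹ F i a j b k c x ij ik jk fi fj fk ag
  with agree-fix2⁻¹ F i a j b x ij fi fj (agree-unfix (fix2 F i a j b) k c x (fix2-free F i a j b k ik jk fk) ag)
... | agF , xi , xj = agF , xi , xj , agree-fixed (fix2 F i a j b) k c x ag

fix2-comm : ∀ {n} (F : Subcube n) i a j b → i ≢ j → fix2 F i a j b ≡ fix2 F j b i a
fix2-comm F i a j b ne = []≔-commutes F i j ne

fix3-swap₂₃ : ∀ {n} (F : Subcube n) i j k (a b c : Bool) → j ≢ k →
              fix2 F i a j b [ k ]≔ just c ≡ fix2 F i a k c [ j ]≔ just b
fix3-swap₂₃ F i j k a b c ne = []≔-commutes (F [ i ]≔ just a) j k ne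

refix : ∀ {n} (F : Subcube n) i j (a a' b : Bool) → i ≢ j → fix2 F i a j b [ i ]≔ just a' ≡ fix2 F i a' j b
refix F i j a a' b ne =
  trans (cong (_[ i ]≔ just a') (fix2-comm F i a j b ne))
        (trans ([]≔-idempotent (F [ j ]≔ just b) i) (sym (fix2-comm F i a' j b ne)))

fix2-≤ : ∀ {n} (F : Subcube n) (P : Cube n → Bool) i a j b → i ≢ j → lookup F i ≡ nothing →
         lookup F j ≡ nothing → count (fix2 F i a j b) P ≤ count F P
fix2-≤ F P i a j b ij fi fj =
  ≤-trans (count-fix-≤ (F [ i ]≔ just a) j b P (free-other F i j (just a) ij fj)) (count-fix-≤ F i a P fi)

Spanning : ∀ {n} → Subcube n → (Cube n → Bool) → Set
Spanning {n} F P = ∀ (j : Fin n) → lookup F j ≡ nothing → ∀ c → 1 ≤ count (F [ j ]≔ just c) P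

SensBounded : ∀ {n} → Subcube n → (Cube n → Bool) → ℕ → Set
SensBounded F P s = ∀ x → Agree F x → P x ≡ true → sensIn F P x ≤ s

Claim : ℕ → Set
Claim k = ∀ {n} (F : Subcube n) (P : Cube n → Bool) (s : ℕ) → dim F ≡ k → 1 ≤ count F P →
          Spanning F P → SensBounded F P s → Bound k s (count F P)

Unspanned : ∀ {n} → Subcube n → (Cube n → Bool) → Fin n → Set
Unspanned F P j = lookup F j ≡ nothing × Σ Bool (λ c → count (F [ j ]≔ just c) P ≡ 0)

unspanned? : ∀ {n} (F : Subcube n) P j → Dec (Unspanned F P j)
unspanned? F P j with ≡-dec _≟ᵇ_ (lookup F j) nothing
... | no ne = no (λ h → ne (proj₁ h))
... | yes e with count (F [ j ]≔ just false) P ≟ 0 | count (F [ j ]≔ just true) P ≟ 0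
...   | yes z | _ = yes (e , false , z)
...   | no _ | yes z = yes (e , true , z)
...   | no n₀ | no n₁ = no λ { (_ , false , z) → n₀ z ; (_ , true , z) → n₁ z }

spanning-or-unspanned : ∀ {n} (F : Subcube n) P → Spanning F P ⊎ Σ (Fin n) (Unspanned F P)
spanning-or-unspanned F P with any? (unspanned? F P)
... | yes ex = inj₂ ex
... | no nex = inj₁ (λ j e c → n≢0⇒n>0 (λ z → nex (j , e , c , z)))

spanning? : ∀ {n} (F : Subcube n) P → Dec (Spanning F P)
spanning? F P with spanning-or-unspanned F P
... | inj₁ sp = yes sp
... | inj₂ (j , e , c , z) = no (λ sp → n≮0 (subst (1 ≤_) z (sp j e c)))

GoodDirection : ∀ {n} → Subcube n → (Cube n → Bool) → Fin n → Set
GoodDirection F P i = lookup F i ≡ nothing × Spanning (F [ i ]≔ just false) P × Spanning (F [ i ]≔ just true) P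

goodDirection? : ∀ {n} (F : Subcube n) P i → Dec (GoodDirection F P i)
goodDirection? F P i
  with ≡-dec _≟ᵇ_ (lookup F i) nothing | spanning? (F [ i ]≔ just false) P | spanning? (F [ i ]≔ just true) P
... | yes e | yes s₀ | yes s₁ = yes (e , s₀ , s₁)
... | no ne | _ | _ = no (λ h → ne (proj₁ h))
... | yes _ | no n₀ | _ = no (λ h → n₀ (proj₁ (proj₂ h)))
... | yes _ | yes _ | no n₁ = no (λ h → n₁ (proj₂ (proj₂ h)))

bool-cases : ∀ f c → f ≡ c ⊎ f ≡ not c
bool-cases false false = inj₁ refl
bool-cases false true = inj₂ refl
bool-cases true false = inj₂ refl
bool-cases true true = inj₁ refl

record EmptyQuarter {n} (F : Subcube n) (P : Cube n → Bool) : Set where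
  constructor quarter
  field
    p q : Fin n
    c e : Bool
    p≢q : p ≢ q
    p-free : lookup F p ≡ nothing
    q-free : lookup F q ≡ nothing
    empty : count (fix2 F p c q e) P ≡ 0

-- The size of the quarter opposite to the empty one; the descent increases it.
opposite : ∀ {n} {F : Subcube n} {P : Cube n → Bool} → EmptyQuarter F P → ℕ
opposite {F = F} {P} Q = count (fix2 F p (not c) q (not e)) P
  where open EmptyQuarter Q

swap-quarter : ∀ {n} {F : Subcube n} {P : Cube n → Bool} → EmptyQuarter F P → EmptyQuarter F P
swap-quarter {F = F} {P} (quarter p q c e pq fp fq emp) =
  quarter q p e c (≢-sym pq) fq fp (trans (count-≡ P (fix2-comm F q e p c (≢-sym pq))) emp)

opposite-swap : ∀ {n} {F : Subcube n} {P : Cube n → Bool} (Q : EmptyQuarter F P) →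
                opposite (swap-quarter Q) ≡ opposite Q
opposite-swap {F = F} {P} (quarter p q c e pq fp fq emp) = count-≡ P (fix2-comm F q (not e) p (not c) (≢-sym pq))

opposite-≤ : ∀ {n} {F : Subcube n} {P : Cube n → Bool} (Q : EmptyQuarter F P) → opposite Q ≤ count F P
opposite-≤ {F = F} {P} (quarter p q c e pq fp fq emp) = fix2-≤ F P p (not c) q (not e) pq fp fq

adjacent-pos : ∀ {n} {F : Subcube n} {P : Cube n → Bool} → Spanning F P → (Q : EmptyQuarter F P) →
               let open EmptyQuarter Q in 1 ≤ count (fix2 F p c q (not e)) P
adjacent-pos {F = F} {P} sp (quarter p q c e pq fp fq emp) =
  subst (1 ≤_) (trans (count-split (F [ p ]≔ just c) q e P (free-other F p q (just c) pq fq))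
                      (cong (_+ count (fix2 F p c q (not e)) P) emp))
        (sp p fp c)

GoodQuarter : ∀ {n} (F : Subcube n) (P : Cube n → Bool) → Set
GoodQuarter F P = Σ (EmptyQuarter F P) (λ Q → let open EmptyQuarter Q in
                    Spanning (F [ p ]≔ just (not c)) P × Spanning (F [ q ]≔ just (not e)) P)

DiagonalQuarter : ∀ {n} (F : Subcube n) (P : Cube n → Bool) → Set
DiagonalQuarter F P = Σ (EmptyQuarter F P) (λ Q → opposite Q ≡ 0)

LargerQuarter : ∀ {n} {F : Subcube n} {P : Cube n → Bool} → EmptyQuarter F P → Set
LargerQuarter {F = F} {P} Q = Σ (EmptyQuarter F P) (λ Q' → suc (opposite Q) ≤ opposite Q')

-- Q = (p=c, q=e) is an empty quarter whose opposite
-- quarter meets P, and the adjacent half F[q≔¬e] is not spanned along l: its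
-- quarter (q=¬e, l=f) misses P.  Then (p=c, l=f) is again an empty quarter, and
-- its opposite quarter consists of the old opposite quarter and a part B; if B
-- misses P, then (q=e, l=¬f) and (q=¬e, l=f) are two opposite empty quarters.
module Growth {n} {F : Subcube n} {P : Cube n → Bool} (sp : Spanning F P) (Q : EmptyQuarter F P)
              (opp-pos : 1 ≤ opposite Q) (l : Fin n) (f : Bool)
              (l-free′ : lookup (F [ EmptyQuarter.q Q ]≔ just (not (EmptyQuarter.e Q))) l ≡ nothing)
              (empty-l : count (fix2 F (EmptyQuarter.q Q) (not (EmptyQuarter.e Q)) l f) P ≡ 0) where
  open EmptyQuarter Q

  q≢l : q ≢ l
  q≢l = fixed-≢ F q l (not e) l-free′

  l-free : lookup F l ≡ nothing
  l-free = free-unfix F q l (not e) q≢l l-free′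

  -- l ≠ p, because both quarters (p=c, q=¬e) and (p=¬c, q=¬e) meet P.
  p≢l : p ≢ l
  p≢l refl with bool-cases f c
  ... | inj₁ refl = n≮0 (subst (1 ≤_) (trans (count-≡ P (fix2-comm F p c q (not e) p≢q)) empty-l)
                               (adjacent-pos sp Q))
  ... | inj₂ refl = n≮0 (subst (1 ≤_) (trans (count-≡ P (fix2-comm F p (not c) q (not e) p≢q)) empty-l)
                               opp-pos)

  misses-Q : ∀ x → Agree F x → lookup x p ≡ c → lookup x q ≡ e → P x ≡ false
  misses-Q x ag xp xq = count-zero⇒false (fix2 F p c q e) P empty x (agree-fix2 F p c q e x ag xp xq)

  misses-l : ∀ x → Agree F x → lookup x q ≡ not e → lookup x l ≡ f → P x ≡ false
  misses-l x ag xq xl =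
    count-zero⇒false (fix2 F q (not e) l f) P empty-l x (agree-fix2 F q (not e) l f x ag xq xl)

  -- The quarter (p=c, l=f) lies in the union of the two empty quarters.
  grown : EmptyQuarter F P
  grown = quarter p l c f p≢l p-free l-free (misses⇒count-zero (fix2 F p c l f) P misses)
    where
      misses : ∀ x → Agree (fix2 F p c l f) x → P x ≡ false
      misses x ag with agree-fix2⁻¹ F p c l f x p≢l p-free l-free ag | bool-cases (lookup x q) e
      ... | agF , xp , xl | inj₁ xq = misses-Q x agF xp xq
      ... | agF , xp , xl | inj₂ xq = misses-l x agF xq xl

  B : ℕ
  B = count (fix2 F p (not c) l (not f) [ q ]≔ just e) P

  old-opposite : count (fix2 F p (not c) l (not f) [ q ]≔ just (not e)) P ≡ opposite Q
  old-opposite = sym (begin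
    count (fix2 F p (not c) q (not e)) P
      ≡⟨ count-split (fix2 F p (not c) q (not e)) l f P (fix2-free F p (not c) q (not e) l p≢l q≢l l-free) ⟩
    count (fix2 F p (not c) q (not e) [ l ]≔ just f) P + count (fix2 F p (not c) q (not e) [ l ]≔ just (not f)) P
      ≡⟨ cong₂ _+_ (misses⇒count-zero (fix2 F p (not c) q (not e) [ l ]≔ just f) P misses)
                   (count-≡ P (fix3-swap₂₃ F p q l (not c) (not e) (not f) q≢l)) ⟩
    count (fix2 F p (not c) l (not f) [ q ]≔ just (not e)) P ∎)
    where
      open ≡-Reasoning
      misses : ∀ x → Agree (fix2 F p (not c) q (not e) [ l ]≔ just f) x → P x ≡ false
      misses x ag with agree-fix3⁻¹ F p (not c) q (not e) l f x p≢q p≢l q≢l p-free q-free l-free ag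
      ... | agF , _ , xq , xl = misses-l x agF xq xl

  grown-opposite : opposite grown ≡ B + opposite Q
  grown-opposite =
    trans (count-split (fix2 F p (not c) l (not f)) q e P (fix2-free F p (not c) l (not f) q p≢q (≢-sym q≢l) q-free))
          (cong (B +_) old-opposite)

  -- If B misses P, so does the quarter (q=e, l=¬f): it lies in Q's quarter and B.
  diagonal : B ≡ 0 → DiagonalQuarter F P
  diagonal z = quarter q l e (not f) q≢l q-free l-free (misses⇒count-zero (fix2 F q e l (not f)) P misses) ,
               trans (count-≡ P (cong (fix2 F q (not e) l) (not-involutive f))) empty-l
    where
      misses : ∀ x → Agree (fix2 F q e l (not f)) x → P x ≡ false
      misses x ag with agree-fix2⁻¹ F q e l (not f) x q≢l q-free l-free ag | bool-cases (lookup x p) c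
      ... | agF , xq , xl | inj₁ xp = misses-Q x agF xp xq
      ... | agF , xq , xl | inj₂ xp =
        count-zero⇒false (fix2 F p (not c) l (not f) [ q ]≔ just e) P z x
                         (agree-fix3 F p (not c) l (not f) q e x agF xp xl xq)

  step : LargerQuarter Q ⊎ DiagonalQuarter F P
  step with B ≟ 0
  ... | yes z = inj₂ (diagonal z)
  ... | no nz = inj₁ (grown , subst (suc (opposite Q) ≤_) (sym grown-opposite)
                                    (+-monoˡ-≤ (opposite Q) (n≢0⇒n>0 nz)))

improve : ∀ {n} {F : Subcube n} {P : Cube n → Bool} → Spanning F P → (Q : EmptyQuarter F P) → 1 ≤ opposite Q →
          GoodQuarter F P ⊎ (LargerQuarter Q ⊎ DiagonalQuarter F P)
improve {F = F} {P} sp Q@(quarter p q c e _ _ _ _) pos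
  with spanning-or-unspanned (F [ q ]≔ just (not e)) P | spanning-or-unspanned (F [ p ]≔ just (not c)) P
... | inj₁ sp-q | inj₁ sp-p = inj₁ (Q , sp-p , sp-q)
... | inj₂ (l , fl , f , zl) | _ = inj₂ (Growth.step sp Q pos l f fl zl)
... | inj₁ _ | inj₂ (l , fl , f , zl) =
  inj₂ (unswap (Growth.step sp (swap-quarter Q) (subst (1 ≤_) (sym (opposite-swap Q)) pos) l f fl zl))
  where
    unswap : LargerQuarter (swap-quarter Q) ⊎ DiagonalQuarter F P → LargerQuarter Q ⊎ DiagonalQuarter F P
    unswap (inj₁ (Q' , lt)) = inj₁ (Q' , subst (λ t → suc t ≤ opposite Q') (opposite-swap Q) lt)
    unswap (inj₂ d) = inj₂ d

-- The descent: iterate improve; the opposite quarter grows and is bounded by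
-- count F P, so within m further steps a good or diagonal quarter appears.
descend : ∀ {n} {F : Subcube n} {P : Cube n → Bool} (m : ℕ) → Spanning F P → (Q : EmptyQuarter F P) →
          count F P ≤ opposite Q + m → GoodQuarter F P ⊎ DiagonalQuarter F P
descend m sp Q h with opposite Q ≟ 0
... | yes z = inj₂ (Q , z)
... | no nz with improve sp Q (n≢0⇒n>0 nz)
...   | inj₁ good = inj₁ good
...   | inj₂ (inj₂ diag) = inj₂ diag
descend {F = F} {P} zero sp Q h | no _ | inj₂ (inj₁ (Q' , lt)) =
  ⊥-elim (<⇒≱ (≤-trans lt (opposite-≤ Q')) (subst (count F P ≤_) (+-identityʳ (opposite Q)) h))
descend (suc m) sp Q h | no _ | inj₂ (inj₁ (Q' , lt)) =
  descend m sp Q' (≤-trans h (subst (_≤ opposite Q' + m) (sym (+-suc (opposite Q) m)) (+-monoˡ-≤ m lt)))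

simon-bound : ∀ {n} (G : Subcube n) (P : Cube n → Bool) (K : ℕ) (h : Cube n → ℕ) → 1 ≤ count G P →
              (∀ y → Agree G y → P y ≡ true → K * 2 ^ sensIn G P y ≤ h y) → K * 2 ^ dim G ≤ sumOver G h
simon-bound G P K h ne pt =
  ≤-trans (*-monoʳ-≤ K (weighted-simon G P ne))
  (≤-trans (≤-reflexive (sym (sumOver-* G K (simonWeight G P)))) (sumOver-mono G pointwise))
  where
    pointwise : ∀ y → Agree G y → K * simonWeight G P y ≤ h y
    pointwise y ag with P y in py
    ... | true = pt y ag py
    ... | false = subst (_≤ h y) (sym (*-zeroʳ K)) z≤n

module Quarters {n} (F : Subcube n) (p q : Fin n) (p≢q : p ≢ q)
                (p-free : lookup F p ≡ nothing) (q-free : lookup F q ≡ nothing) where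

  q-free′ : ∀ a → lookup (F [ p ]≔ just a) q ≡ nothing
  q-free′ a = free-other F p q (just a) p≢q q-free

  agree-quarter : ∀ a b x → Agree (fix2 F p a q b) x → Agree F x × lookup x p ≡ a × lookup x q ≡ b
  agree-quarter a b x = agree-fix2⁻¹ F p a q b x p≢q p-free q-free

  dim-quarters : ∀ a b → dim F ≡ suc (suc (dim (fix2 F p a q b)))
  dim-quarters a b = trans (dim-fix F p a p-free) (cong suc (dim-fix (F [ p ]≔ just a) q b (q-free′ a)))

  dim-quarter : ∀ a b m → dim F ≡ suc (suc m) → dim (fix2 F p a q b) ≡ m
  dim-quarter a b m d = sym (suc-injective (suc-injective (trans (sym d) (dim-quarters a b))))

  count-quarters : ∀ a b (P : Cube n → Bool) →
                   count F P ≡ (count (fix2 F p a q b) P + count (fix2 F p a q (not b)) P) +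
                               (count (fix2 F p (not a) q b) P + count (fix2 F p (not a) q (not b)) P)
  count-quarters a b P = trans (count-split F p a P p-free)
    (cong₂ _+_ (count-split (F [ p ]≔ just a) q b P (q-free′ a))
               (count-split (F [ p ]≔ just (not a)) q b P (q-free′ (not a))))

  sensIn-quarter : ∀ a b (P : Cube n → Bool) x →
                   sensIn F P x ≡
                   ind (not (P (flipAt p x))) + (ind (not (P (flipAt q x))) + sensIn (fix2 F p a q b) P x)
  sensIn-quarter a b P x =
    trans (sensIn-fix F p a P x p-free)
          (cong (ind (not (P (flipAt p x))) +_) (sensIn-fix (F [ p ]≔ just a) q b P x (q-free′ a)))

  lookup-quarter-p : ∀ a b → lookup (fix2 F p a q b) p ≡ just a
  lookup-quarter-p a b = trans (lookup∘update′ p≢q (F [ p ]≔ just a) (just b)) (lookup∘update p F (just a))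

  sensIn-quarter-p : ∀ a a' b (P : Cube n → Bool) x →
                     sensIn (fix2 F p a q b) P x ≡ sensIn (fix2 F p a' q b) P x
  sensIn-quarter-p a a' b P x =
    trans (cong (λ H → sensIn H P x) (fix2-comm F p a q b p≢q))
          (trans (sensIn-refix (F [ q ]≔ just b) p a a' P x)
                 (cong (λ H → sensIn H P x) (sym (fix2-comm F p a' q b p≢q))))

  agree-flip-p : ∀ a b x → Agree (fix2 F p a q b) x → Agree (fix2 F p (not a) q b) (flipAt p x)
  agree-flip-p a b x ag = subst (λ H → Agree H (flipAt p x)) (refix F p q a (not a) b p≢q)
                                (agree-flip (fix2 F p a q b) p a x (lookup-quarter-p a b) ag)

  agree-flip-q : ∀ a b x → Agree (fix2 F p a q b) x → Agree (fix2 F p a q (not b)) (flipAt q x)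
  agree-flip-q a b x ag = subst (λ H → Agree H (flipAt q x)) ([]≔-idempotent (F [ p ]≔ just a) q)
                                (agree-flip (fix2 F p a q b) q b x (lookup∘update q (F [ p ]≔ just a) (just b)) ag)

  sumOver-flip-p : ∀ a b (g : Cube n → ℕ) →
                   sumOver (fix2 F p a q b) (λ x → g (flipAt p x)) ≡ sumOver (fix2 F p (not a) q b) g
  sumOver-flip-p a b g = trans (sumOver-flip (fix2 F p a q b) p a g (lookup-quarter-p a b))
                               (cong (λ H → sumOver H g) (refix F p q a (not a) b p≢q))

  p-neighbour-zero : ∀ a b (P : Cube n → Bool) → count (fix2 F p (not a) q b) P ≡ 0 →
                     ∀ x → Agree (fix2 F p a q b) x → P (flipAt p x) ≡ false
  p-neighbour-zero a b P z x ag =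
    count-zero⇒false (fix2 F p (not a) q b) P z (flipAt p x) (agree-flip-p a b x ag)

  q-neighbour-zero : ∀ a b (P : Cube n → Bool) → count (fix2 F p a q (not b)) P ≡ 0 →
                     ∀ x → Agree (fix2 F p a q b) x → P (flipAt q x) ≡ false
  q-neighbour-zero a b P z x ag =
    count-zero⇒false (fix2 F p a q (not b)) P z (flipAt q x) (agree-flip-q a b x ag)

pow-≤ : ∀ t u s → t + u ≤ s → 2 ^ t * 2 ^ u ≤ 2 ^ s
pow-≤ t u s h = subst (_≤ 2 ^ s) (^-distribˡ-+-* 2 t u) (^-monoʳ-≤ 2 h)

-- An isolated quarter: if both neighbouring quarters of G = (p=a, q=b) miss P,
-- every 1-point of G loses two sensitive directions to p and q, and the
-- weighted Simon lemma gives |P ∩ G| ≥ 2^(m+2-s).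
isolated-quarter : ∀ {n} (F : Subcube n) (P : Cube n → Bool) (s m : ℕ) (p q : Fin n) (a b : Bool) (p≢q : p ≢ q)
  (p-free : lookup F p ≡ nothing) (q-free : lookup F q ≡ nothing) → dim F ≡ suc (suc m) → SensBounded F P s →
  1 ≤ count (fix2 F p a q b) P → count (fix2 F p (not a) q b) P ≡ 0 → count (fix2 F p a q (not b)) P ≡ 0 →
  2 ^ suc (suc m) ≤ 2 ^ s * count (fix2 F p a q b) P
isolated-quarter F P s m p q a b p≢q p-free q-free d sb ne zp zq =
  subst₂ _≤_ (trans (cong (λ k → 4 * 2 ^ k) (dim-quarter a b m d)) (*-assoc 2 2 (2 ^ m)))
             (sumOver-* G (2 ^ s) (λ y → ind (P y)))
             (simon-bound G P 4 (λ y → 2 ^ s * ind (P y)) ne pointwise)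
  where
    open Quarters F p q p≢q p-free q-free
    G : Subcube _
    G = fix2 F p a q b
    pointwise : ∀ y → Agree G y → P y ≡ true → 4 * 2 ^ sensIn G P y ≤ 2 ^ s * ind (P y)
    pointwise y ag py =
      subst (4 * 2 ^ sensIn G P y ≤_) (sym (trans (cong (λ b → 2 ^ s * ind b) py) (*-identityʳ (2 ^ s))))
      (pow-≤ 2 (sensIn G P y) s (subst (_≤ s) sens-eq (sb y (proj₁ (agree-quarter a b y ag)) py)))
      where
        sens-eq : sensIn F P y ≡ 2 + sensIn G P y
        sens-eq = trans (sensIn-quarter a b P y)
                        (cong₂ (λ u v → ind (not u) + (ind (not v) + sensIn G P y))
                               (p-neighbour-zero a b P zp y ag) (q-neighbour-zero a b P zq y ag))

∨-trueʳ : ∀ u {w} → w ≡ true → u ∨ w ≡ true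
∨-trueʳ u refl = ∨-zeroʳ u

ind-∨∧ : ∀ u w → ind (u ∨ w) + ind (u ∧ w) ≡ ind u + ind w
ind-∨∧ true true = refl
ind-∨∧ true false = refl
ind-∨∧ false true = refl
ind-∨∧ false false = refl

-- The weight bound for a 1-point of X in Fold below: it is sensitive along q,
-- and also along p unless its p-neighbour w is a 1-point.
fold-weight : ∀ t s w → ind (not w) + suc t ≤ suc s → 4 * 2 ^ t ≤ 2 ^ suc s * (1 + ind w)
fold-weight t s true h = subst (4 * 2 ^ t ≤_) (*-comm 2 (2 ^ suc s)) (pow-≤ 2 t (2 + s) (s≤s h))
fold-weight t s false h = subst (4 * 2 ^ t ≤_) (sym (*-identityʳ (2 ^ suc s))) (pow-≤ 2 t (suc s) h)

-- Let X = (p=¬a, q=b)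
-- be the other quarter of the half and assume that the quarter (p=¬a, q=¬b)
-- next to X misses P.  The fold P₁ = P ∨ P∘flip_p on G meets G, is spanning
-- if the half is, and loses one unit of sensitivity; its size is
-- |P ∩ G| + |P ∩ X| - paired, where paired counts the points x of G with
-- both x and its p-neighbour in P.
module Fold {n} (F : Subcube n) (P : Cube n → Bool) (p q : Fin n) (p≢q : p ≢ q)
            (p-free : lookup F p ≡ nothing) (q-free : lookup F q ≡ nothing) (a b : Bool) where
  open Quarters F p q p≢q p-free q-free

  G X : Subcube n
  G = fix2 F p a q b
  X = fix2 F p (not a) q b

  P₁ : Cube n → Bool
  P₁ x = P x ∨ P (flipAt p x)

  paired : ℕ
  paired = sumOver G (λ x → ind (P x ∧ P (flipAt p x)))

  fold-count : count G P₁ + paired ≡ count G P + count X P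
  fold-count = begin
    count G P₁ + paired
      ≡⟨ sym (sumOver-+ G _ _) ⟩
    sumOver G (λ x → ind (P₁ x) + ind (P x ∧ P (flipAt p x)))
      ≡⟨ sumOver-ext G (λ x _ → ind-∨∧ (P x) (P (flipAt p x))) ⟩
    sumOver G (λ x → ind (P x) + ind (P (flipAt p x)))
      ≡⟨ sumOver-+ G _ _ ⟩
    count G P + sumOver G (λ x → ind (P (flipAt p x)))
      ≡⟨ cong (count G P +_) (sumOver-flip-p a b (λ y → ind (P y))) ⟩
    count G P + count X P ∎
    where open ≡-Reasoning

  paired-X : paired ≡ sumOver X (λ y → ind (P y ∧ P (flipAt p y)))
  paired-X =
    trans (sumOver-ext G (λ x _ → cong (λ z → ind (P z ∧ P (flipAt p x))) (sym (flipAt-involutive p x))))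
    (trans (sumOver-flip-p a b (λ y → ind (P (flipAt p y) ∧ P y)))
           (sumOver-ext X (λ y _ → cong ind (∧-comm (P (flipAt p y)) (P y)))))

  fold-meets : 1 ≤ count X P → 1 ≤ count G P₁
  fold-meets ne = ≤-trans ne (subst (_≤ count G P₁) (sumOver-flip-p a b (λ y → ind (P y)))
    (sumOver-mono G (λ x _ → ind-mono (P (flipAt p x)) (P₁ x) (∨-trueʳ (P x)))))
    where
      ind-mono : ∀ u w → (u ≡ true → w ≡ true) → ind u ≤ ind w
      ind-mono false w h = z≤n
      ind-mono true w h rewrite h refl = ≤-refl

  -- A quarter H = (q=b, j=v) of the half F[q≔b] meets P in some y; then y or
  -- its p-neighbour is a 1-point of P₁ in G[j≔v].
  fold-spans : Spanning (F [ q ]≔ just b) P → Spanning G P₁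
  fold-spans sp j j-free′ v =
    in-slice (count-pos⇒point (fix2 F q b j v) P (sp j (free-other F q j (just b) q≢j j-free) v))
    where
      q≢j : q ≢ j
      q≢j = fixed-≢ (F [ p ]≔ just a) q j b j-free′
      p≢j : p ≢ j
      p≢j = fixed-≢ F p j a (free-unfix (F [ p ]≔ just a) q j b q≢j j-free′)
      j-free : lookup F j ≡ nothing
      j-free = free-unfix F p j a p≢j (free-unfix (F [ p ]≔ just a) q j b q≢j j-free′)

      in-slice : Σ (Cube n) (λ y → Agree (fix2 F q b j v) y × P y ≡ true) → 1 ≤ count (G [ j ]≔ just v) P₁
      in-slice (y , ag , py) with agree-fix2⁻¹ F q b j v y q≢j q-free j-free ag | bool-cases (lookup y p) a
      ... | agF , yq , yj | inj₁ yp =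
        count-point⇒pos (G [ j ]≔ just v) P₁ y (agree-fix3 F p a q b j v y agF yp yq yj)
                        (cong (_∨ P (flipAt p y)) py)
      ... | agF , yq , yj | inj₂ yp =
        count-point⇒pos (G [ j ]≔ just v) P₁ (flipAt p y)
          (agree-fix3 F p a q b j v (flipAt p y) (agree-flip-free F p y p-free agF)
                      (trans (lookup-flip p y) (trans (cong not yp) (not-involutive a)))
                      (trans (lookup-flip-other p q y p≢q) yq) (trans (lookup-flip-other p j y p≢j) yj))
          (∨-trueʳ (P (flipAt p y)) (trans (cong P (flipAt-involutive p y)) py))

  module _ (z : count (fix2 F p (not a) q (not b)) P ≡ 0) where

    sens-X : ∀ y → Agree X y → sensIn F P y ≡ ind (not (P (flipAt p y))) + suc (sensIn X P y)
    sens-X y ag = trans (sensIn-quarter (not a) b P y)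
                        (cong (λ u → ind (not (P (flipAt p y))) + (ind (not u) + sensIn X P y))
                              (q-neighbour-zero (not a) b P z y ag))

    X-empty-at-zero : SensBounded F P 0 → count X P ≡ 0
    X-empty-at-zero sb = misses⇒count-zero X P misses
      where
        misses : ∀ y → Agree X y → P y ≡ false
        misses y ag with P y in py
        ... | false = refl
        ... | true with () ← m+n≤o⇒n≤o (ind (not (P (flipAt p y))))
                               (subst (_≤ 0) (sens-X y ag) (sb y (proj₁ (agree-quarter (not a) b y ag)) py))

    fold-sens : ∀ s → SensBounded F P (suc s) → SensBounded G P₁ s
    fold-sens s sb x ag p₁x with P (flipAt p x) in pfx
    ... | true =
      ≤-trans (sensIn-antitone G (λ y → P (flipAt p y)) P₁ (λ y → ∨-trueʳ (P y)) x)
              (subst (_≤ s) (sym (trans (sensIn-flip G p a P x (lookup-quarter-p a b))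
                                        (sensIn-quarter-p a (not a) b P (flipAt p x))))
                     (s≤s⁻¹ (m+n≤o⇒n≤o _ (subst (_≤ suc s) (sens-X (flipAt p x) agY)
                                                 (sb (flipAt p x) (agree-F (flipAt p x) agY) pfx)))))
      where
        agY : Agree X (flipAt p x)
        agY = agree-flip-p a b x ag
        agree-F : ∀ y → Agree X y → Agree F y
        agree-F y agY = proj₁ (agree-quarter (not a) b y agY)
    ... | false =
      ≤-trans (sensIn-antitone G P P₁ (λ y e → cong (_∨ P (flipAt p y)) e) x)
              (m+n≤o⇒n≤o _ (s≤s⁻¹ (subst (_≤ suc s) sens-eq (sb x (proj₁ (agree-quarter a b x ag)) px))))
      where
        px : P x ≡ true
        px = trans (sym (∨-identityʳ (P x))) p₁x
        sens-eq : sensIn F P x ≡ suc (ind (not (P (flipAt q x))) + sensIn G P x)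
        sens-eq = trans (sensIn-quarter a b P x)
                        (cong (λ u → ind (not u) + (ind (not (P (flipAt q x))) + sensIn G P x)) pfx)

    -- Weighted Simon on X: points whose p-neighbour is in P count twice.
    X-simon : ∀ m s → dim F ≡ suc (suc m) → SensBounded F P (suc s) → 1 ≤ count X P →
              2 ^ suc (suc m) ≤ 2 ^ suc s * (count X P + paired)
    X-simon m s d sb ne =
      subst₂ _≤_ (trans (cong (λ k → 4 * 2 ^ k) (dim-quarter (not a) b m d)) (*-assoc 2 2 (2 ^ m)))
                 (trans (sumOver-* X (2 ^ suc s) _)
                        (cong (2 ^ suc s *_) (trans (sumOver-+ X _ _) (cong (count X P +_) (sym paired-X)))))
                 (simon-bound X P 4 (λ y → 2 ^ suc s * (ind (P y) + ind (P y ∧ P (flipAt p y)))) ne pointwise)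
      where
        pointwise : ∀ y → Agree X y → P y ≡ true →
                    4 * 2 ^ sensIn X P y ≤ 2 ^ suc s * (ind (P y) + ind (P y ∧ P (flipAt p y)))
        pointwise y ag py rewrite py =
          fold-weight (sensIn X P y) s (P (flipAt p y))
            (subst (_≤ suc s) (sens-X y ag) (sb y (proj₁ (agree-quarter (not a) b y ag)) py))

-- One half of the good-quarter case: fold the half F[q≔b] onto G = (p=a, q=b),
-- apply the claim to the fold at sensitivity s - 1 and combine it with the
-- Simon bound on X = (p=¬a, q=b).  For s = 0 the quarter X cannot meet P.
fold-bound : ∀ m → Claim m → ∀ {n} (F : Subcube n) (P : Cube n → Bool) (s : ℕ) (p q : Fin n) (a b : Bool)
  (p≢q : p ≢ q) (p-free : lookup F p ≡ nothing) (q-free : lookup F q ≡ nothing) →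
  dim F ≡ suc (suc m) → SensBounded F P s → Spanning (F [ q ]≔ just b) P →
  count (fix2 F p (not a) q (not b)) P ≡ 0 → 1 ≤ count (fix2 F p (not a) q b) P →
  Bound (suc (suc m)) s (count (fix2 F p a q b) P + (count (fix2 F p (not a) q b) P + count (fix2 F p (not a) q b) P))
fold-bound m ih F P zero p q a b p≢q p-free q-free d sb sp z ne =
  ⊥-elim (n≮0 (subst (1 ≤_) (Fold.X-empty-at-zero F P p q p≢q p-free q-free a b z sb) ne))
fold-bound m ih F P (suc s) p q a b p≢q p-free q-free d sb sp z ne =
  bound-fold m s (count G P₁) paired (count X P) (count G P)
    (ih G P₁ s (dim-quarter a b m d) (fold-meets ne) (fold-spans sp) (fold-sens z s sb))
    (X-simon z m s d sb ne) fold-count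
  where
    open Quarters F p q p≢q p-free q-free
    open Fold F P p q p≢q p-free q-free a b

good-direction-bound : ∀ k → Claim k → ∀ {n} (F : Subcube n) (P : Cube n → Bool) (s : ℕ) → dim F ≡ suc k →
                       Spanning F P → SensBounded F P s → (i : Fin n) → GoodDirection F P i →
                       Bound (suc k) s (count F P)
good-direction-bound k ih F P s d sp sb i (i-free , sp₀ , sp₁) =
  subst (Bound (suc k) s) (sym (sumOver-split F i (λ x → ind (P x)) i-free))
        (bound-halves k s _ _ (half false sp₀) (half true sp₁))
  where
    half : ∀ c → Spanning (F [ i ]≔ just c) P → Bound k s (count (F [ i ]≔ just c) P)
    half c sp-c = ih (F [ i ]≔ just c) P s (suc-injective (trans (sym (dim-fix F i c i-free)) d)) (sp i i-free c) sp-c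
      (λ x ag px → ≤-trans (≤-trans (m≤n+m _ _) (≤-reflexive (sym (sensIn-fix F i c P x i-free))))
                           (sb x (agree-unfix F i c x i-free ag) px))

-- A diagonal quarter: the two remaining quarters are isolated, so each has at
-- least 2^(k-s) points.
diagonal-bound : ∀ m {n} (F : Subcube n) (P : Cube n → Bool) (s : ℕ) → dim F ≡ suc (suc m) →
                 Spanning F P → SensBounded F P s → DiagonalQuarter F P → Bound (suc (suc m)) s (count F P)
diagonal-bound m F P s d sp sb (Q@(quarter p q c e p≢q p-free q-free empty) , z) =
  subst (Bound (suc (suc m)) s)
        (sym (trans (count-quarters c e P) (cong₂ _+_ (cong (_+ X) empty) (trans (cong (Y +_) z) (+-identityʳ Y)))))
        (bound-diagonal (suc (suc m)) s X Y
          (isolated-quarter F P s m p q c (not e) p≢q p-free q-free d sb (adjacent-pos sp Q) z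
             (trans (count-≡ P (cong (fix2 F p c q) (not-involutive e))) empty))
          (isolated-quarter F P s m p q (not c) e p≢q p-free q-free d sb
             (subst (1 ≤_) (count-≡ P (fix2-comm F q e p (not c) (≢-sym p≢q))) (adjacent-pos sp (swap-quarter Q)))
             (trans (count-≡ P (cong (λ t → fix2 F p t q e) (not-involutive c))) empty) z))
  where
    open Quarters F p q p≢q p-free q-free
    X Y : ℕ
    X = count (fix2 F p c q (not e)) P
    Y = count (fix2 F p (not c) q e) P

-- A good quarter Q = (p=c, q=e): folding each of the two spanned adjacent
-- halves onto the opposite quarter Z gives bounds for Z + 2X and Z + 2Y, where
-- X = (p=c, q=¬e) and Y = (p=¬c, q=e); their average bounds X + Y + Z = |P ∩ F|.
good-quarter-bound : ∀ m → Claim m → ∀ {n} (F : Subcube n) (P : Cube n → Bool) (s : ℕ) →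
                     dim F ≡ suc (suc m) →
                     Spanning F P → SensBounded F P s → GoodQuarter F P → Bound (suc (suc m)) s (count F P)
good-quarter-bound m ih F P s d sp sb (Q@(quarter p q c e p≢q p-free q-free empty) , sp-p , sp-q) =
  subst (Bound (suc (suc m)) s) (sym (trans (count-quarters c e P) (cong (λ t → (t + X) + (Y + Z)) empty)))
        (bound-average (suc (suc m)) s X Y Z
          (subst (λ u → Bound (suc (suc m)) s (Z + (u + u))) eX
                 (fold-bound m ih F P s p q (not c) (not e) p≢q p-free q-free d sb sp-q
                    (trans (count-≡ P (cong₂ (λ u v → fix2 F p u q v) (not-involutive c) (not-involutive e))) empty)
                    (subst (1 ≤_) (sym eX) (adjacent-pos sp Q))))
          (subst₂ (λ u v → Bound (suc (suc m)) s (u + (v + v))) eZ eY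
                 (fold-bound m ih F P s q p (not e) (not c) (≢-sym p≢q) q-free p-free d sb sp-p
                    (trans (count-≡ P (trans (cong₂ (λ u v → fix2 F q u p v) (not-involutive e) (not-involutive c))
                                             (fix2-comm F q e p c (≢-sym p≢q)))) empty)
                    (subst (1 ≤_) (sym eY) (subst (1 ≤_) (count-≡ P (fix2-comm F q e p (not c) (≢-sym p≢q)))
                                                          (adjacent-pos sp (swap-quarter Q)))))))
  where
    open Quarters F p q p≢q p-free q-free
    X Y Z : ℕ
    X = count (fix2 F p c q (not e)) P
    Y = count (fix2 F p (not c) q e) P
    Z = count (fix2 F p (not c) q (not e)) P
    eX : count (fix2 F p (not (not c)) q (not e)) P ≡ X
    eX = count-≡ P (cong (λ t → fix2 F p t q (not e)) (not-involutive c))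
    eY : count (fix2 F q (not (not e)) p (not c)) P ≡ Y
    eY = count-≡ P (trans (cong (λ t → fix2 F q t p (not c)) (not-involutive e))
                          (fix2-comm F q e p (not c) (≢-sym p≢q)))
    eZ : count (fix2 F q (not e) p (not c)) P ≡ Z
    eZ = count-≡ P (fix2-comm F q (not e) p (not c) (≢-sym p≢q))

quarter-of-unspanned-half : ∀ {n} (F : Subcube n) (P : Cube n → Bool) (i j : Fin n) (c : Bool) →
                            lookup F i ≡ nothing → Unspanned (F [ i ]≔ just c) P j → EmptyQuarter F P
quarter-of-unspanned-half F P i j c i-free (j-free′ , c' , z) =
  quarter i j c c' i≢j i-free (free-unfix F i j c i≢j j-free′) z
  where i≢j : i ≢ j
        i≢j = fixed-≢ F i j c j-free′

empty-quarter : ∀ {n} (F : Subcube n) (P : Cube n → Bool) k → dim F ≡ suc k →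
                ¬ Σ (Fin n) (GoodDirection F P) → EmptyQuarter F P
empty-quarter F P k d none with free-exists F k d
... | i , i-free with spanning-or-unspanned (F [ i ]≔ just false) P | spanning-or-unspanned (F [ i ]≔ just true) P
...   | inj₁ sp₀ | inj₁ sp₁ = ⊥-elim (none (i , i-free , sp₀ , sp₁))
...   | inj₂ (j , u) | _ = quarter-of-unspanned-half F P i j false i-free u
...   | inj₁ _ | inj₂ (j , u) = quarter-of-unspanned-half F P i j true i-free u

quarter-bound : ∀ k → (∀ {m} → m < suc k → Claim m) →
                ∀ {n} (F : Subcube n) (P : Cube n → Bool) (s : ℕ) →
                dim F ≡ suc k → Spanning F P → SensBounded F P s → EmptyQuarter F P → Bound (suc k) s (count F P)
quarter-bound k ih F P s d sp sb Q@(quarter p q c e p≢q p-free q-free _) =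
  subst (λ t → Bound t s (count F P)) (sym k≡m)
        ([ good-quarter-bound m (ih m<k) F P s d′ sp sb , diagonal-bound m F P s d′ sp sb ]′
           (descend (count F P) sp Q (m≤n+m (count F P) (opposite Q))))
  where
    m : ℕ
    m = dim (fix2 F p c q e)
    d′ : dim F ≡ suc (suc m)
    d′ = Quarters.dim-quarters F p q p≢q p-free q-free c e
    k≡m : suc k ≡ suc (suc m)
    k≡m = trans (sym d) d′
    m<k : m < suc k
    m<k = subst (m <_) (sym k≡m) (m<n⇒m<1+n (n<1+n m))

claim-step : ∀ k → (∀ {m} → m < k → Claim m) → Claim k
claim-step zero ih F P s d ne sp sb = bound-point s (count F P) ne
claim-step (suc k) ih F P s d ne sp sb with any? (goodDirection? F P)
... | yes (i , good) = good-direction-bound k (ih ≤-refl) F P s d sp sb i good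
... | no none = quarter-bound k ih F P s d sp sb (empty-quarter F P k d none)

claim : ∀ k → Claim k
claim = <-rec Claim claim-step

length-filterᵇ-∷ : ∀ {A : Set} (g : A → Bool) x xs →
                   length (filterᵇ g (x ∷ xs)) ≡ ind (g x) + length (filterᵇ g xs)
length-filterᵇ-∷ g x xs with g x
... | true = refl
... | false = refl

length-filterᵇ-map : ∀ {A B : Set} (g : B → Bool) (h : A → B) (xs : List A) →
                     length (filterᵇ g (map h xs)) ≡ length (filterᵇ (λ a → g (h a)) xs)
length-filterᵇ-map g h [] = refl
length-filterᵇ-map g h (x ∷ xs) =
  trans (length-filterᵇ-∷ g (h x) (map h xs))
        (trans (cong (ind (g (h x)) +_) (length-filterᵇ-map g h xs)) (sym (length-filterᵇ-∷ (λ a → g (h a)) x xs)))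

length-filterᵇ-++ : ∀ {A : Set} (g : A → Bool) (xs ys : List A) →
                    length (filterᵇ g (xs ++ ys)) ≡ length (filterᵇ g xs) + length (filterᵇ g ys)
length-filterᵇ-++ g xs ys = trans (cong length (filter-++ (λ x → T? (g x)) xs ys)) (length-++ (filterᵇ g xs))

count-whole : ∀ n (f : BoolFun n) → count (whole n) f ≡ weight f
count-whole zero f = sym (trans (length-filterᵇ-∷ f [] []) (+-identityʳ (ind (f []))))
count-whole (suc n) f = sym (begin
  weight f
    ≡⟨ length-filterᵇ-++ f (map (false ∷_) (allCube n)) (map (true ∷_) (allCube n)) ⟩
  length (filterᵇ f (map (false ∷_) (allCube n))) + length (filterᵇ f (map (true ∷_) (allCube n)))
    ≡⟨ cong₂ _+_ (length-filterᵇ-map f (false ∷_) (allCube n)) (length-filterᵇ-map f (true ∷_) (allCube n)) ⟩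
  weight (λ y → f (false ∷ y)) + weight (λ y → f (true ∷ y))
    ≡⟨ sym (cong₂ _+_ (count-whole n (λ y → f (false ∷ y))) (count-whole n (λ y → f (true ∷ y)))) ⟩
  count (whole (suc n)) f ∎)
  where open ≡-Reasoning

sensIn-whole : ∀ n (P : Cube n → Bool) x →
               sensIn (whole n) P x ≡ length (filterᵇ (λ i → not (P (flipAt i x))) (allFin n))
sensIn-whole zero P [] = refl
sensIn-whole (suc n) P (b ∷ x) =
  trans (cong (ind (not (P (not b ∷ x))) +_)
              (trans (sensIn-whole n (λ y → P (b ∷ y)) x)
                     (sym (trans (cong (λ is → length (filterᵇ g is)) (sym (map-tabulate id suc)))
                                 (length-filterᵇ-map g suc (allFin n))))))
        (sym (length-filterᵇ-∷ g zero (tabulate suc)))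
  where g : Fin (suc n) → Bool
        g i = not (P (flipAt i (b ∷ x)))

sensIn-whole-sens : ∀ n (f : BoolFun n) x → f x ≡ true → sensIn (whole n) f x ≡ sens f x
sensIn-whole-sens n f x fx =
  trans (sensIn-whole n f x) (cong (λ b → length (filterᵇ (λ i → b xor f (flipAt i x)) (allFin n))) (sym fx))

in-allCube : ∀ n (x : Cube n) → x ∈ allCube n
in-allCube zero [] = here refl
in-allCube (suc n) (false ∷ x) = ∈-++⁺ˡ (∈-map⁺ (false ∷_) (in-allCube n x))
in-allCube (suc n) (true ∷ x) = ∈-++⁺ʳ (map (false ∷_) (allCube n)) (∈-map⁺ (true ∷_) (in-allCube n x))

foldr-⊔-≥ : ∀ {A : Set} (g : A → ℕ) {y : A} (xs : List A) → y ∈ xs → g y ≤ foldr _⊔_ 0 (map g xs)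
foldr-⊔-≥ g (x ∷ xs) (here refl) = m≤m⊔n (g x) _
foldr-⊔-≥ g (x ∷ xs) (there h) = ≤-trans (foldr-⊔-≥ g xs h) (m≤n⊔m (g x) _)

sens-≤-s₁ : ∀ n (f : BoolFun n) x → f x ≡ true → sens f x ≤ s₁ f
sens-≤-s₁ n f x fx =
  foldr-⊔-≥ (sens f) (filterᵇ f (allCube n)) (∈-filter⁺ (λ y → T? (f y)) (in-allCube n x) (subst T (sym fx) tt))

corollary2 : (n : ℕ) → 1 ≤ n → (f : BoolFun n) →
    ((i : Fin n) (j : Bool) → Σ (Cube n) (λ x → lookup x i ≡ j × f x ≡ true)) →
    2 ^ (n + s₁ f + 1) ≤ 2 ^ (2 * s₁ f) * weight f + 2 ^ n
corollary2 (suc n) _ f half-spaces =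
  subst (Bound (suc n) (s₁ f)) (count-whole (suc n) f)
        (claim (suc n) (whole (suc n)) f (s₁ f) (dim-whole (suc n)) meets spans bounded)
  where
    meets : 1 ≤ count (whole (suc n)) f
    meets with half-spaces zero true
    ... | x , _ , fx = count-point⇒pos (whole (suc n)) f x (agree-whole (suc n) x) fx
    spans : Spanning (whole (suc n)) f
    spans j _ c with half-spaces j c
    ... | x , xj , fx = count-point⇒pos (whole (suc n) [ j ]≔ just c) f x
                          (agree-fix (whole (suc n)) j c x (agree-whole (suc n) x) xj) fx
    bounded : SensBounded (whole (suc n)) f (s₁ f)
    bounded x _ fx = subst (_≤ s₁ f) (sym (sensIn-whole-sens (suc n) f x fx)) (sens-≤-s₁ (suc n) f x fx)
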